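{- Let $\mathbb{F}$ be a field of characteristic not $2$, and let $a,b,c\in\mathbb{F}^2$ with $a\ne b$, $\|a\|=\|b\|\ne 0$, $c\ne0$ and $\|c\|=0$. Then $\|a-c\|\neq\|b-c\|$.
   Context: For $x=(x_1,x_2)\in\mathbb{F}^2$, $\|x\|=x_1^2+x_2^2$. -}

module Defs where

open import Level using (_⊔_)
open import Algebra.Bundles using (CommutativeRing)
open import Data.Product using (_×_; _,_; ∃)
open import Relation.Nullary using (¬_)

record IsField {c ℓ} (F : CommutativeRing c ℓ) : Set (c ⊔ ℓ) where
  open CommutativeRing F
  field
    1≉0     : ¬ (1# ≈ 0#)
    inverse : ∀ x → ¬ (x ≈ 0#) → ∃ λ y → x * y ≈ 1#

module Plane {c ℓ} (F : CommutativeRing c ℓ) where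
  open CommutativeRing F

  F² : Set c
  F² = Carrier × Carrier

  _≈²_ : F² → F² → Set ℓ
  (x₁ , x₂) ≈² (y₁ , y₂) = (x₁ ≈ y₁) × (x₂ ≈ y₂)

  0² : F²
  0² = (0# , 0#)

  _-²_ : F² → F² → F²
  (x₁ , x₂) -² (y₁ , y₂) = (x₁ - y₁ , x₂ - y₂)

  ‖_‖ : F² → Carrier
  ‖ (x₁ , x₂) ‖ = x₁ * x₁ + x₂ * x₂

-- From ‖a − z‖ = ‖b − z‖ and ‖a‖ = ‖b‖ one gets z ⊥ a − b.  In the plane, a vector
-- orthogonal to a nonzero isotropic z is isotropic: Lagrange's identity
-- (z∙w)² + det(z, w)² = ‖z‖‖w‖ forces det(z, w) = 0, i.e. w is a multiple of z.
-- So a − b is nonzero isotropic, and a + b ⊥ a − b is isotropic as well; the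
-- parallelogram law then gives 4‖a‖ = ‖a + b‖ + ‖a − b‖ = 0.  Without decidable
-- equality on F, "is isotropic" is only obtained doubly negated, which suffices
-- because the goal is a negation.
module Submission where

open import Defs

open import Algebra.Bundles using (CommutativeRing; RawRing)
open import Data.Maybe using (Maybe; just; nothing)
open import Data.Nat as ℕ using (ℕ)
open import Data.Product using (_×_; _,_; proj₁)
open import Relation.Binary.PropositionalEquality using (_≡_; cong)
open import Relation.Nullary using (¬_; yes; no)
import Algebra.Properties.CommutativeSemigroup as CommutativeSemigroupProperties
import Algebra.Properties.Ring as RingProperties
import Algebra.Properties.Semiring.Mult as SemiringMultiplication
import Algebra.Solver.Ring
open import Algebra.Solver.Ring.AlmostCommutativeRing using (fromCommutativeRing; _-Raw-AlmostCommutative⟶_)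
import Relation.Binary.Reasoning.Setoid as SetoidReasoning

-- Integer coefficients for the ring solver, as formal differences (p , q) of naturals:
-- the homomorphism into any commutative ring is then simply p × 1# - q × 1#.  The solver
-- compares coefficients only through their images (_≟⟦⟧_), so _≡_ on pairs is harmless.
ℕ-differences : RawRing _ _
ℕ-differences = record
  { Carrier = ℕ × ℕ
  ; _≈_     = _≡_
  ; _+_     = λ { (p , q) (p′ , q′) → (p ℕ.+ p′ , q ℕ.+ q′) }
  ; _*_     = λ { (p , q) (p′ , q′) → (p ℕ.* p′ ℕ.+ q ℕ.* q′ , p ℕ.* q′ ℕ.+ q ℕ.* p′) }
  ; -_      = λ { (p , q) → (q , p) }
  ; 0#      = (0 , 0)
  ; 1#      = (1 , 0)
  }

module RingSolver {c ℓ} (R : CommutativeRing c ℓ) where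
  open CommutativeRing R
  open RingProperties ring using (-0#≈0#; -‿+-comm; ⁻¹-anti-homo‿-; -‿distribˡ-*; -‿distribʳ-*; -‿involutive)
  open CommutativeSemigroupProperties +-commutativeSemigroup using (interchange)
  open SemiringMultiplication semiring using (×-homo-+; ×1-homo-*) renaming (_×_ to _·_)
  open SetoidReasoning setoid

  private
    -‿+-interchange : ∀ a b c d → (a + b) - (c + d) ≈ (a - c) + (b - d)
    -‿+-interchange a b c d = begin
      (a + b) + - (c + d)     ≈⟨ +-congˡ (-‿+-comm c d) ⟨
      (a + b) + (- c + - d)   ≈⟨ interchange a b (- c) (- d) ⟩
      (a - c) + (b - d)       ∎

    -‿*-expand : ∀ a b c d → (a - b) * (c - d) ≈ (a * c + b * d) - (a * d + b * c)
    -‿*-expand a b c d = begin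
      (a - b) * (c - d)                              ≈⟨ distribʳ (c - d) a (- b) ⟩
      a * (c - d) + - b * (c - d)                    ≈⟨ +-cong (distribˡ a c (- d)) (distribˡ (- b) c (- d)) ⟩
      (a * c + a * - d) + (- b * c + - b * - d)      ≈⟨ +-cong (+-congˡ (-‿distribʳ-* a d)) (+-cong (-‿distribˡ-* b c) bd≈-b*-d) ⟨
      (a * c + - (a * d)) + (- (b * c) + b * d)      ≈⟨ +-congˡ (+-comm (- (b * c)) (b * d)) ⟩
      (a * c + - (a * d)) + (b * d + - (b * c))      ≈⟨ -‿+-interchange (a * c) (b * d) (a * d) (b * c) ⟨
      (a * c + b * d) - (a * d + b * c)              ∎
      where
      bd≈-b*-d : b * d ≈ - b * - d
      bd≈-b*-d = trans (sym (-‿involutive (b * d))) (trans (-‿cong (-‿distribʳ-* b d)) (-‿distribˡ-* b (- d)))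

    a+d≈c+b⇒a-b≈c-d : ∀ {a b c d} → a + d ≈ c + b → a - b ≈ c - d
    a+d≈c+b⇒a-b≈c-d {a} {b} {c} {d} eq = begin
      a - b                  ≈⟨ +-identityʳ (a - b) ⟨
      (a - b) + 0#           ≈⟨ +-congˡ (-‿inverseʳ d) ⟨
      (a - b) + (d - d)      ≈⟨ -‿+-interchange a d b d ⟨
      (a + d) - (b + d)      ≈⟨ +-cong eq (-‿cong (+-comm b d)) ⟩
      (c + b) - (d + b)      ≈⟨ -‿+-interchange c b d b ⟩
      (c - d) + (b - b)      ≈⟨ +-congˡ (-‿inverseʳ b) ⟩
      (c - d) + 0#           ≈⟨ +-identityʳ (c - d) ⟩
      c - d                  ∎

    ι : ℕ → Carrier
    ι n = n · 1#

    ι-homo-+ : ∀ m n → ι (m ℕ.+ n) ≈ ι m + ι n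
    ι-homo-+ = ×-homo-+ 1#

    ι-homo-*+* : ∀ m n p q → ι (m ℕ.* n ℕ.+ p ℕ.* q) ≈ ι m * ι n + ι p * ι q
    ι-homo-*+* m n p q = trans (ι-homo-+ (m ℕ.* n) (p ℕ.* q)) (+-cong (×1-homo-* m n) (×1-homo-* p q))

    ⟦_⟧ : ℕ × ℕ → Carrier
    ⟦ p , q ⟧ = ι p - ι q

    ⟦⟧-respects : ∀ {p q p′ q′} → p ℕ.+ q′ ≡ p′ ℕ.+ q → ⟦ p , q ⟧ ≈ ⟦ p′ , q′ ⟧
    ⟦⟧-respects {p} {q} {p′} {q′} eq = a+d≈c+b⇒a-b≈c-d (begin
      ι p + ι q′       ≈⟨ ι-homo-+ p q′ ⟨
      ι (p ℕ.+ q′)     ≡⟨ cong ι eq ⟩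
      ι (p′ ℕ.+ q)     ≈⟨ ι-homo-+ p′ q ⟩
      ι p′ + ι q       ∎)

    morphism : ℕ-differences -Raw-AlmostCommutative⟶ fromCommutativeRing R
    morphism = record
      { ⟦_⟧    = ⟦_⟧
      ; +-homo = λ { (p , q) (p′ , q′) →
          trans (+-cong (ι-homo-+ p p′) (-‿cong (ι-homo-+ q q′))) (-‿+-interchange (ι p) (ι p′) (ι q) (ι q′)) }
      ; *-homo = λ { (p , q) (p′ , q′) →
          trans (+-cong (ι-homo-*+* p p′ q q′) (-‿cong (ι-homo-*+* p q′ q p′))) (sym (-‿*-expand (ι p) (ι q) (ι p′) (ι q′))) }
      ; -‿homo = λ { (p , q) → sym (⁻¹-anti-homo‿- (ι p) (ι q)) }
      ; 0-homo = -‿inverseʳ 0#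
      ; 1-homo = trans (+-congʳ (+-identityʳ 1#)) (trans (+-congˡ -0#≈0#) (+-identityʳ 1#))
      }

    _≟⟦⟧_ : ∀ x y → Maybe (⟦ x ⟧ ≈ ⟦ y ⟧)
    (p , q) ≟⟦⟧ (p′ , q′) with p ℕ.+ q′ ℕ.≟ p′ ℕ.+ q
    ... | yes eq = just (⟦⟧-respects {p} {q} {p′} {q′} eq)
    ... | no _   = nothing

  open Algebra.Solver.Ring ℕ-differences (fromCommutativeRing R) morphism _≟⟦⟧_ public
    using (solve; _:=_; _:+_; _:-_; _:*_)

module FieldProperties {c ℓ} (F : CommutativeRing c ℓ) (isField : IsField F) where
  open CommutativeRing F
  open IsField isField
  open SetoidReasoning setoid

  x≉0∧x*y≈0⇒y≈0 : ∀ {x y} → ¬ (x ≈ 0#) → x * y ≈ 0# → y ≈ 0#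
  x≉0∧x*y≈0⇒y≈0 {x} {y} x≉0 xy≈0 with inverse x x≉0
  ... | x⁻¹ , xx⁻¹≈1 = begin
    y              ≈⟨ *-identityˡ y ⟨
    1# * y         ≈⟨ *-congʳ xx⁻¹≈1 ⟨
    (x * x⁻¹) * y  ≈⟨ *-congʳ (*-comm x x⁻¹) ⟩
    (x⁻¹ * x) * y  ≈⟨ *-assoc x⁻¹ x y ⟩
    x⁻¹ * (x * y)  ≈⟨ *-congˡ xy≈0 ⟩
    x⁻¹ * 0#       ≈⟨ zeroʳ x⁻¹ ⟩
    0#             ∎

  x≉0⇒x*x≉0 : ∀ {x} → ¬ (x ≈ 0#) → ¬ (x * x ≈ 0#)
  x≉0⇒x*x≉0 x≉0 xx≈0 = x≉0 (x≉0∧x*y≈0⇒y≈0 x≉0 xx≈0)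

  x+x≈0⇒x≈0 : ∀ {x} → ¬ (1# + 1# ≈ 0#) → x + x ≈ 0# → x ≈ 0#
  x+x≈0⇒x≈0 {x} 2≉0 x+x≈0 = x≉0∧x*y≈0⇒y≈0 2≉0 (begin
    (1# + 1#) * x    ≈⟨ distribʳ x 1# 1# ⟩
    1# * x + 1# * x  ≈⟨ +-cong (*-identityˡ x) (*-identityˡ x) ⟩
    x + x            ≈⟨ x+x≈0 ⟩
    0#               ∎)

module PlaneGeometry {c ℓ} (F : CommutativeRing c ℓ) where
  open CommutativeRing F
  open Plane F
  open RingSolver F using (solve; _:=_; _:+_; _:-_; _:*_)
  open RingProperties ring using (x∙y⁻¹≈ε⇒x≈y)

  infix 7 _∙_

  _+²_ : F² → F² → F²
  (x₁ , x₂) +² (y₁ , y₂) = (x₁ + y₁ , x₂ + y₂)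

  _∙_ : F² → F² → Carrier
  (x₁ , x₂) ∙ (y₁ , y₂) = x₁ * y₁ + x₂ * y₂

  det : F² → F² → Carrier
  det (x₁ , x₂) (y₁ , y₂) = x₁ * y₂ - x₂ * y₁

  ‖-‖-polarisation : ∀ x y z → ‖ y -² z ‖ - ‖ x -² z ‖ + (‖ x ‖ - ‖ y ‖) ≈ z ∙ (x -² y) + z ∙ (x -² y)
  ‖-‖-polarisation (x₁ , x₂) (y₁ , y₂) (z₁ , z₂) = solve 6 (λ x₁ x₂ y₁ y₂ z₁ z₂ →
      (y₁ :- z₁) :* (y₁ :- z₁) :+ (y₂ :- z₂) :* (y₂ :- z₂) :- ((x₁ :- z₁) :* (x₁ :- z₁) :+ (x₂ :- z₂) :* (x₂ :- z₂))
        :+ (x₁ :* x₁ :+ x₂ :* x₂ :- (y₁ :* y₁ :+ y₂ :* y₂))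
      := (z₁ :* (x₁ :- y₁) :+ z₂ :* (x₂ :- y₂)) :+ (z₁ :* (x₁ :- y₁) :+ z₂ :* (x₂ :- y₂)))
    refl x₁ x₂ y₁ y₂ z₁ z₂

  ∙-difference-of-squares : ∀ x y → (x -² y) ∙ (x +² y) ≈ ‖ x ‖ - ‖ y ‖
  ∙-difference-of-squares (x₁ , x₂) (y₁ , y₂) = solve 4 (λ x₁ x₂ y₁ y₂ →
      (x₁ :- y₁) :* (x₁ :+ y₁) :+ (x₂ :- y₂) :* (x₂ :+ y₂) := x₁ :* x₁ :+ x₂ :* x₂ :- (y₁ :* y₁ :+ y₂ :* y₂))
    refl x₁ x₂ y₁ y₂

  parallelogram-law : ∀ x y → ‖ x +² y ‖ + ‖ x -² y ‖ ≈ (‖ x ‖ + ‖ y ‖) + (‖ x ‖ + ‖ y ‖)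
  parallelogram-law (x₁ , x₂) (y₁ , y₂) = solve 4 (λ x₁ x₂ y₁ y₂ →
      (x₁ :+ y₁) :* (x₁ :+ y₁) :+ (x₂ :+ y₂) :* (x₂ :+ y₂) :+ ((x₁ :- y₁) :* (x₁ :- y₁) :+ (x₂ :- y₂) :* (x₂ :- y₂))
      := (x₁ :* x₁ :+ x₂ :* x₂ :+ (y₁ :* y₁ :+ y₂ :* y₂)) :+ (x₁ :* x₁ :+ x₂ :* x₂ :+ (y₁ :* y₁ :+ y₂ :* y₂)))
    refl x₁ x₂ y₁ y₂

  lagrange-identity : ∀ x y → det x y * det x y ≈ ‖ x ‖ * ‖ y ‖ - (x ∙ y) * (x ∙ y)
  lagrange-identity (x₁ , x₂) (y₁ , y₂) = solve 4 (λ x₁ x₂ y₁ y₂ →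
      (x₁ :* y₂ :- x₂ :* y₁) :* (x₁ :* y₂ :- x₂ :* y₁)
      := (x₁ :* x₁ :+ x₂ :* x₂) :* (y₁ :* y₁ :+ y₂ :* y₂) :- (x₁ :* y₁ :+ x₂ :* y₂) :* (x₁ :* y₁ :+ x₂ :* y₂))
    refl x₁ x₂ y₁ y₂

  -- ‖y‖ x₁² = y₁² ‖x‖ modulo det x y, the relation saying that y is a multiple of x.
  ‖-‖*fst²-via-det : ∀ x₁ x₂ y₁ y₂ →
    ‖ (y₁ , y₂) ‖ * (x₁ * x₁) ≈ (y₁ * y₁) * ‖ (x₁ , x₂) ‖ + (y₁ * x₂ + y₂ * x₁) * det (x₁ , x₂) (y₁ , y₂)
  ‖-‖*fst²-via-det = solve 4 (λ x₁ x₂ y₁ y₂ →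
      (y₁ :* y₁ :+ y₂ :* y₂) :* (x₁ :* x₁)
      := (y₁ :* y₁) :* (x₁ :* x₁ :+ x₂ :* x₂) :+ (y₁ :* x₂ :+ y₂ :* x₁) :* (x₁ :* y₂ :- x₂ :* y₁))
    refl

  x-²y≈²0²⇒x≈²y : ∀ {x y} → (x -² y) ≈² 0² → x ≈² y
  x-²y≈²0²⇒x≈²y {x₁ , x₂} {y₁ , y₂} (e₁ , e₂) = x∙y⁻¹≈ε⇒x≈y x₁ y₁ e₁ , x∙y⁻¹≈ε⇒x≈y x₂ y₂ e₂

module IsotropicVectors {c ℓ} (F : CommutativeRing c ℓ) (isField : IsField F) where
  open CommutativeRing F
  open Plane F
  open PlaneGeometry F
  open FieldProperties F isField
  open SetoidReasoning setoid

  isotropic∧≉²0²⇒fst≉0 : ∀ {z} → ‖ z ‖ ≈ 0# → ¬ (z ≈² 0²) → ¬ (proj₁ z ≈ 0#)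
  isotropic∧≉²0²⇒fst≉0 {z₁ , z₂} ‖z‖≈0 z≉0 z₁≈0 = x≉0⇒x*x≉0 z₂≉0 (begin
    z₂ * z₂              ≈⟨ +-identityˡ (z₂ * z₂) ⟨
    0# + z₂ * z₂         ≈⟨ +-congʳ (zeroˡ z₁) ⟨
    0# * z₁ + z₂ * z₂    ≈⟨ +-congʳ (*-congʳ z₁≈0) ⟨
    ‖ (z₁ , z₂) ‖        ≈⟨ ‖z‖≈0 ⟩
    0#                   ∎)
    where
    z₂≉0 : ¬ (z₂ ≈ 0#)
    z₂≉0 z₂≈0 = z≉0 (z₁≈0 , z₂≈0)

  orthogonal-to-isotropic⇒isotropic : ∀ {z w} → ‖ z ‖ ≈ 0# → ¬ (z ≈² 0²) → z ∙ w ≈ 0# → ¬ ¬ (‖ w ‖ ≈ 0#)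
  orthogonal-to-isotropic⇒isotropic {z₁ , z₂} {w₁ , w₂} ‖z‖≈0 z≉0 z∙w≈0 ‖w‖≉0 = x≉0⇒x*x≉0 det≉0 (begin
    det z w * det z w                ≈⟨ lagrange-identity z w ⟩
    ‖ z ‖ * ‖ w ‖ - (z ∙ w) * (z ∙ w) ≈⟨ +-cong (*-congʳ ‖z‖≈0) (-‿cong (*-congʳ z∙w≈0)) ⟩
    0# * ‖ w ‖ - 0# * (z ∙ w)         ≈⟨ +-cong (zeroˡ _) (-‿cong (zeroˡ _)) ⟩
    0# - 0#                           ≈⟨ -‿inverseʳ 0# ⟩
    0#                                ∎)
    where
    z w : F²
    z = z₁ , z₂
    w = w₁ , w₂
    det≉0 : ¬ (det z w ≈ 0#)
    det≉0 det≈0 = ‖w‖≉0 (x≉0∧x*y≈0⇒y≈0 (x≉0⇒x*x≉0 (isotropic∧≉²0²⇒fst≉0 ‖z‖≈0 z≉0)) (begin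
      (z₁ * z₁) * ‖ w ‖                                   ≈⟨ *-comm (z₁ * z₁) ‖ w ‖ ⟩
      ‖ w ‖ * (z₁ * z₁)                                   ≈⟨ ‖-‖*fst²-via-det z₁ z₂ w₁ w₂ ⟩
      (w₁ * w₁) * ‖ z ‖ + (w₁ * z₂ + w₂ * z₁) * det z w    ≈⟨ +-cong (*-congˡ ‖z‖≈0) (*-congˡ det≈0) ⟩
      (w₁ * w₁) * 0# + (w₁ * z₂ + w₂ * z₁) * 0#           ≈⟨ +-cong (zeroʳ _) (zeroʳ _) ⟩
      0# + 0#                                             ≈⟨ +-identityʳ 0# ⟩
      0#                                                  ∎))

lemma7 : ∀ {c ℓ} (F : CommutativeRing c ℓ) → IsField F →
           ¬ (CommutativeRing._≈_ F (CommutativeRing._+_ F (CommutativeRing.1# F) (CommutativeRing.1# F)) (CommutativeRing.0# F)) →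
           (a b z : Plane.F² F) →
           ¬ (Plane._≈²_ F a b) →
           CommutativeRing._≈_ F (Plane.‖_‖ F a) (Plane.‖_‖ F b) →
           ¬ (CommutativeRing._≈_ F (Plane.‖_‖ F a) (CommutativeRing.0# F)) →
           ¬ (Plane._≈²_ F z (Plane.0² F)) →
           CommutativeRing._≈_ F (Plane.‖_‖ F z) (CommutativeRing.0# F) →
           ¬ (CommutativeRing._≈_ F (Plane.‖_‖ F (Plane._-²_ F a z)) (Plane.‖_‖ F (Plane._-²_ F b z)))
lemma7 F isField 2≉0 a b z a≉b ‖a‖≈‖b‖ ‖a‖≉0 z≉0 ‖z‖≈0 ‖a-z‖≈‖b-z‖ =
  orthogonal-to-isotropic⇒isotropic ‖z‖≈0 z≉0 z⊥a-b λ ‖a-b‖≈0 →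
  orthogonal-to-isotropic⇒isotropic ‖a-b‖≈0 a-b≉0 a-b⊥a+b λ ‖a+b‖≈0 →
  ‖a‖≉0 (x+x≈0⇒x≈0 2≉0 (begin
    ‖ a ‖ + ‖ a ‖  ≈⟨ +-congˡ ‖a‖≈‖b‖ ⟩
    ‖ a ‖ + ‖ b ‖  ≈⟨ x+x≈0⇒x≈0 2≉0 (begin
      (‖ a ‖ + ‖ b ‖) + (‖ a ‖ + ‖ b ‖)  ≈⟨ parallelogram-law a b ⟨
      ‖ a +² b ‖ + ‖ a -² b ‖           ≈⟨ +-cong ‖a+b‖≈0 ‖a-b‖≈0 ⟩
      0# + 0#                           ≈⟨ +-identityʳ 0# ⟩
      0#                                ∎) ⟩
    0#             ∎))
  where
  open CommutativeRing F
  open Plane F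
  open PlaneGeometry F
  open FieldProperties F isField
  open IsotropicVectors F isField
  open RingProperties ring using (x≈y⇒x∙y⁻¹≈ε)
  open SetoidReasoning setoid

  z⊥a-b : z ∙ (a -² b) ≈ 0#
  z⊥a-b = x+x≈0⇒x≈0 2≉0 (begin
    z ∙ (a -² b) + z ∙ (a -² b)                  ≈⟨ ‖-‖-polarisation a b z ⟨
    ‖ b -² z ‖ - ‖ a -² z ‖ + (‖ a ‖ - ‖ b ‖)     ≈⟨ +-cong (x≈y⇒x∙y⁻¹≈ε (sym ‖a-z‖≈‖b-z‖)) (x≈y⇒x∙y⁻¹≈ε ‖a‖≈‖b‖) ⟩
    0# + 0#                                      ≈⟨ +-identityʳ 0# ⟩
    0#                                           ∎)

  a-b≉0 : ¬ ((a -² b) ≈² 0²)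
  a-b≉0 a-b≈0 = a≉b (x-²y≈²0²⇒x≈²y a-b≈0)

  a-b⊥a+b : (a -² b) ∙ (a +² b) ≈ 0#
  a-b⊥a+b = trans (∙-difference-of-squares a b) (x≈y⇒x∙y⁻¹≈ε ‖a‖≈‖b‖)
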